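{- If $T_1$ and $T_2$ are trees each of order at least $3$, then $\mu(T_1\,\square\, T_2)\ge \mu(T_1)\,\mu(T_2)$.
   Context: All graphs are finite, simple, undirected. For a connected graph $G$ and $X\subseteq V(G)$, two vertices $x,y\in X$ are $X$-visible if there is a shortest $x,y$-path $P$ in $G$ with $V(P)\cap X=\{x,y\}$; $X$ is a mutual-visibility set if all pairs of its vertices are $X$-visible; $\mu(G)$ is the largest size of a mutual-visibility set of $G$. $G\,\square\, H$ denotes the Cartesian product (vertex set $V(G)\times V(H)$, $(g,h)\sim(g',h')$ iff ($gg'\in E(G)$ and $h=h'$) or ($g=g'$ and $hh'\in E(H)$)). -}

module Defs where

open import Data.Nat using (ℕ; zero; suc; _≤_)
open import Data.Fin using (Fin)
open import Data.Bool using (Bool; T)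
open import Data.Product using (_×_; _,_; Σ; ∃; ∃-syntax; proj₁; proj₂)
open import Data.Sum using (_⊎_)
open import Data.List using (List; []; _∷_; length)
open import Data.List.Membership.Propositional using (_∈_)
open import Data.List.Relation.Unary.Unique.Propositional using (Unique)
open import Relation.Binary.PropositionalEquality using (_≡_)
open import Relation.Nullary using (¬_)

module _ {V : Set} (E : V → V → Set) where

  data Walk : V → V → Set where
    nil  : (x : V) → Walk x x
    cons : (x : V) {y z : V} → E x y → Walk y z → Walk x z

  len : ∀ {x y} → Walk x y → ℕ
  len (nil x)      = zero
  len (cons x e w) = suc (len w)

  verts : ∀ {x y} → Walk x y → List V
  verts (nil x)      = x ∷ []
  verts (cons x e w) = x ∷ verts w

  IsPath : ∀ {x y} → Walk x y → Set
  IsPath w = Unique (verts w)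

  -- a shortest x,y-path: no x,y-walk is shorter
  -- (a shortest walk automatically has distinct vertices)
  IsShortest : ∀ {x y} → Walk x y → Set
  IsShortest {x} {y} w = (w' : Walk x y) → len w ≤ len w'

  Connected : Set
  Connected = (x y : V) → Walk x y

  -- a cycle: a path x = v₀,…,v_k = y with k ≥ 2 together with the edge y x
  HasCycle : Set
  HasCycle = ∃[ x ] ∃[ y ] Σ (Walk x y) (λ w → IsPath w × 2 ≤ len w × E y x)

  Visible : List V → V → V → Set
  Visible X x y = Σ (Walk x y) λ P →
    IsShortest P × ((v : V) → v ∈ verts P → v ∈ X → (v ≡ x ⊎ v ≡ y))

  -- X is a mutual-visibility set (X a set of vertices, given as a
  -- duplicate-free list; |X| = length X)
  IsMVSet : List V → Set
  IsMVSet X = Unique X × ((x y : V) → x ∈ X → y ∈ X → Visible X x y)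

  IsMu : ℕ → Set
  IsMu m = (Σ (List V) λ X → IsMVSet X × length X ≡ m)
         × ((X : List V) → IsMVSet X → length X ≤ m)

record Graph (n : ℕ) : Set where
  field
    adj     : Fin n → Fin n → Bool
    adj-sym : ∀ x y → T (adj x y) → T (adj y x)
    irrefl  : ∀ x → ¬ T (adj x x)

  Adj : Fin n → Fin n → Set
  Adj x y = T (adj x y)

open Graph public

IsTree : ∀ {n} → Graph n → Set
IsTree G = Connected (Adj G) × ¬ HasCycle (Adj G)

□-Adj : ∀ {n m} → Graph n → Graph m → (Fin n × Fin m) → (Fin n × Fin m) → Set
□-Adj G H (g , h) (g' , h') = (Adj G g g' × h ≡ h') ⊎ (g ≡ g' × Adj H h h')

{-# OPTIONS --safe #-}
module Submission where

-- If X₁ is an independent mutual-visibility set of any graph G and X₂ one of any graph H,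
-- then X₁ × X₂ is one of G □ H: to join (x,y) and (x',y'), take a shortest x,x'-path of
-- length ≥ 2, and after its first step g traverse a whole shortest y,y'-path in the fibre
-- of g, which misses X₁ × X₂ because g ∉ X₁ (symmetrically if the y,y'-path is the long
-- one); if both are single edges, x and x' would be adjacent.
-- If a maximum mutual-visibility set of the tree T₁ is not independent, acyclicity forces
-- it to be a single edge, so μ(T₁) ≤ 2, and the ends of any path of length 2 in T₁ (which
-- exists as T₁ has ≥ 3 vertices) form an independent mutual-visibility set of size 2.
-- Nothing about T₂ beyond being a graph is needed.

open import Defs
open import Data.Nat using (ℕ; suc; _≤_; _*_; _+_; z≤n; s≤s; _≤?_)
open import Data.Nat.Properties using (≤-refl; ≤-trans; m≤n⇒m≤1+n; 1+n≰n; +-mono-≤; +-suc; +-comm; *-monoˡ-≤)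
open import Data.Fin using (Fin; _≟_) renaming (zero to 0F; suc to sucF)
open import Data.Product using (_×_; _,_; Σ; proj₁; proj₂)
import Data.Product as Prod
open import Data.Sum using (_⊎_; inj₁; inj₂)
import Data.Sum as Sum
open import Data.List using (List; []; _∷_; length; map; _++_; cartesianProduct)
open import Data.List.Properties using (length-++; length-map)
open import Data.List.Membership.Propositional using (_∈_; _∉_)
open import Data.List.Membership.Propositional.Properties
  using (∈-map⁻; ∈-cartesianProduct⁻; ∈-cartesianProduct⁺)
open import Data.List.Relation.Binary.Subset.Propositional using (_⊆_)
open import Data.List.Relation.Unary.Any using (here; there)
open import Data.List.Relation.Unary.All using (lookup; []; _∷_)
open import Data.List.Relation.Unary.All.Properties.Core using (¬Any⇒All¬)
open import Data.List.Relation.Unary.AllPairs using (_∷_; [])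
open import Data.List.Relation.Unary.Unique.Propositional using (Unique)
open import Data.List.Relation.Unary.Unique.Propositional.Properties using (cartesianProduct⁺)
open import Data.Empty using (⊥-elim)
open import Function using (_∘_)
open import Relation.Binary.Definitions using (DecidableEquality)
open import Relation.Binary.PropositionalEquality
open import Relation.Nullary using (¬_; yes; no)
import Data.List.Membership.DecPropositional as DecMembership

module WalkProperties {V : Set} (E : V → V → Set) where

  infixr 5 _++ʷ_
  _++ʷ_ : ∀ {a b c} → Walk E a b → Walk E b c → Walk E a c
  nil _       ++ʷ W₂ = W₂
  cons x e W₁ ++ʷ W₂ = cons x e (W₁ ++ʷ W₂)

  len-++ʷ : ∀ {a b c} (W₁ : Walk E a b) (W₂ : Walk E b c) →
            len E (W₁ ++ʷ W₂) ≡ len E W₁ + len E W₂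
  len-++ʷ (nil _)       W₂ = refl
  len-++ʷ (cons _ _ W₁) W₂ = cong suc (len-++ʷ W₁ W₂)

  ∈-verts-++ʷ⁻ : ∀ {a b c v} (W₁ : Walk E a b) (W₂ : Walk E b c) →
                 v ∈ verts E (W₁ ++ʷ W₂) → v ∈ verts E W₁ ⊎ v ∈ verts E W₂
  ∈-verts-++ʷ⁻ (nil _)       W₂ v∈        = inj₂ v∈
  ∈-verts-++ʷ⁻ (cons _ _ W₁) W₂ (here eq) = inj₁ (here eq)
  ∈-verts-++ʷ⁻ (cons _ _ W₁) W₂ (there v∈) = Sum.map₁ there (∈-verts-++ʷ⁻ W₁ W₂ v∈)

  head∈verts : ∀ {a b} (W : Walk E a b) → a ∈ verts E W
  head∈verts (nil _)      = here refl
  head∈verts (cons _ _ _) = here refl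

  suffix : ∀ {s a b} (W : Walk E s b) → a ∈ verts E W →
           Σ (Walk E a b) λ S → len E S ≤ len E W × verts E S ⊆ verts E W
                              × (IsPath E W → IsPath E S)
  suffix (nil _)      (here refl) = nil _ , ≤-refl , (λ v∈ → v∈) , (λ u → u)
  suffix (cons _ e W) (here refl) = cons _ e W , ≤-refl , (λ v∈ → v∈) , (λ u → u)
  suffix (cons _ e W) (there a∈) with suffix W a∈
  ... | S , S≤W , S⊆W , path = S , m≤n⇒m≤1+n S≤W , there ∘ S⊆W , λ { (_ ∷ u) → path u }

  -- Loop erasure: whenever the new head already occurs, cut back to its later occurrence.
  walk⇒path : DecidableEquality V → ∀ {a b} (W : Walk E a b) →
              Σ (Walk E a b) λ P → IsPath E P × verts E P ⊆ verts E W
  walk⇒path _≟_ (nil a) = nil a , [] ∷ [] , λ v∈ → v∈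
  walk⇒path _≟_ (cons a e W) with walk⇒path _≟_ W
  ... | P , pathP , P⊆W with DecMembership._∈?_ _≟_ a (verts E P)
  ...   | yes a∈P = let (S , _ , S⊆P , pathS) = suffix P a∈P
                    in S , pathS pathP , there ∘ P⊆W ∘ S⊆P
  ...   | no a∉P  = cons a e P , ¬Any⇒All¬ _ a∉P ∷ pathP ,
                    λ { (here eq) → here eq ; (there v∈) → there (P⊆W v∈) }

  shortest-head∉tail : ∀ {x g y} (e : E x g) (P : Walk E g y) →
                       IsShortest E (cons x e P) → x ∉ verts E P
  shortest-head∉tail e P shortest x∈P =
    let (S , S≤P , _) = suffix P x∈P in 1+n≰n (≤-trans (shortest S) S≤P)

  shortest-second≢last : ∀ {x g g' y} (e : E x g) (e' : E g g') (P : Walk E g' y) →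
                         IsShortest E (cons x e (cons g e' P)) → g ≢ y
  shortest-second≢last {x} e e' P shortest refl with shortest (cons x e (nil _))
  ... | s≤s ()

  TwoStep : Set
  TwoStep = Σ V λ a → Σ V λ b → Σ V λ c → E a b × E b c × a ≢ c

  path⇒twoStep⊎adjacent : ∀ {x z} (P : Walk E x z) → IsPath E P → x ≢ z → TwoStep ⊎ E x z
  path⇒twoStep⊎adjacent (nil _)                   _                 x≢z = ⊥-elim (x≢z refl)
  path⇒twoStep⊎adjacent (cons _ e (nil _))        _                 _   = inj₂ e
  path⇒twoStep⊎adjacent (cons x e (cons b e' P)) ((_ ∷ x∉) ∷ _) _   =
    inj₁ (x , b , _ , e , e' , lookup x∉ (head∈verts P))

  2≤len : ∀ {a c} → a ≢ c → ¬ E a c → (W : Walk E a c) → 2 ≤ len E W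
  2≤len a≢c _     (nil _)                 = ⊥-elim (a≢c refl)
  2≤len _   ¬a~c  (cons _ e (nil _))      = ⊥-elim (¬a~c e)
  2≤len _   _     (cons _ _ (cons _ _ _)) = s≤s (s≤s z≤n)

Independent : {V : Set} → (V → V → Set) → List V → Set
Independent E X = ∀ {u v} → u ∈ X → v ∈ X → ¬ E u v

length-cartesianProduct : {A B : Set} (xs : List A) (ys : List B) →
                          length (cartesianProduct xs ys) ≡ length xs * length ys
length-cartesianProduct []       ys = refl
length-cartesianProduct (x ∷ xs) ys = begin
  length (map (x ,_) ys ++ cartesianProduct xs ys)      ≡⟨ length-++ (map (x ,_) ys) ⟩
  length (map (x ,_) ys) + length (cartesianProduct xs ys) ≡⟨ cong₂ _+_ (length-map (x ,_) ys) (length-cartesianProduct xs ys) ⟩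
  length ys + length xs * length ys                      ∎
  where open ≡-Reasoning

module CartesianProduct {n₁ n₂ : ℕ} (G : Graph n₁) (H : Graph n₂) where

  open WalkProperties (□-Adj G H) using (_++ʷ_; len-++ʷ; ∈-verts-++ʷ⁻)
  open WalkProperties (Adj G) using (shortest-head∉tail; shortest-second≢last)

  liftˡ : ∀ h {g g'} → Walk (Adj G) g g' → Walk (□-Adj G H) (g , h) (g' , h)
  liftˡ h (nil g)      = nil (g , h)
  liftˡ h (cons g e W) = cons (g , h) (inj₁ (e , refl)) (liftˡ h W)

  liftʳ : ∀ g {h h'} → Walk (Adj H) h h' → Walk (□-Adj G H) (g , h) (g , h')
  liftʳ g (nil h)      = nil (g , h)
  liftʳ g (cons h e W) = cons (g , h) (inj₂ (refl , e)) (liftʳ g W)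

  len-liftˡ : ∀ h {g g'} (W : Walk (Adj G) g g') → len (□-Adj G H) (liftˡ h W) ≡ len (Adj G) W
  len-liftˡ h (nil _)      = refl
  len-liftˡ h (cons _ _ W) = cong suc (len-liftˡ h W)

  len-liftʳ : ∀ g {h h'} (W : Walk (Adj H) h h') → len (□-Adj G H) (liftʳ g W) ≡ len (Adj H) W
  len-liftʳ g (nil _)      = refl
  len-liftʳ g (cons _ _ W) = cong suc (len-liftʳ g W)

  verts-liftˡ : ∀ h {g g'} (W : Walk (Adj G) g g') →
                verts (□-Adj G H) (liftˡ h W) ≡ map (_, h) (verts (Adj G) W)
  verts-liftˡ h (nil _)      = refl
  verts-liftˡ h (cons _ _ W) = cong (_ ∷_) (verts-liftˡ h W)

  verts-liftʳ : ∀ g {h h'} (W : Walk (Adj H) h h') →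
                verts (□-Adj G H) (liftʳ g W) ≡ map (g ,_) (verts (Adj H) W)
  verts-liftʳ g (nil _)      = refl
  verts-liftʳ g (cons _ _ W) = cong (_ ∷_) (verts-liftʳ g W)

  project : ∀ {p q} (W : Walk (□-Adj G H) p q) →
            Σ (Walk (Adj G) (proj₁ p) (proj₁ q)) λ P → Σ (Walk (Adj H) (proj₂ p) (proj₂ q)) λ Q →
            len (Adj G) P + len (Adj H) Q ≡ len (□-Adj G H) W
  project (nil _) = nil _ , nil _ , refl
  project (cons (g , h) (inj₁ (e , refl)) W) =
    let (P , Q , eq) = project W in cons g e P , Q , cong suc eq
  project (cons (g , h) (inj₂ (refl , e)) W) =
    let (P , Q , eq) = project W in P , cons h e Q , trans (+-suc (len (Adj G) P) (len (Adj H) Q)) (cong suc eq)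

  shortest-of-length : ∀ {x x' y y'} {P : Walk (Adj G) x x'} {Q : Walk (Adj H) y y'} →
                       IsShortest (Adj G) P → IsShortest (Adj H) Q →
                       (W : Walk (□-Adj G H) (x , y) (x' , y')) →
                       len (□-Adj G H) W ≡ len (Adj G) P + len (Adj H) Q → IsShortest (□-Adj G H) W
  shortest-of-length shortestP shortestQ W W≡P+Q W' =
    let (P' , Q' , P'+Q'≡W') = project W' in
    subst₂ _≤_ (sym W≡P+Q) P'+Q'≡W' (+-mono-≤ (shortestP P') (shortestQ Q'))

  module _ (X : List (Fin n₁)) (Y : List (Fin n₂)) where

    visible-alongʳ : ∀ {x y y'} → Visible (Adj H) Y y y' →
                     Visible (□-Adj G H) (cartesianProduct X Y) (x , y) (x , y')
    visible-alongʳ {x} {y} {y'} (Q , shortestQ , avoidQ) =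
      liftʳ x Q , shortest-of-length {P = nil x} (λ _ → z≤n) shortestQ (liftʳ x Q) (len-liftʳ x Q) , avoid
      where
      avoid : ∀ v → v ∈ verts (□-Adj G H) (liftʳ x Q) → v ∈ cartesianProduct X Y →
              v ≡ (x , y) ⊎ v ≡ (x , y')
      avoid v v∈W v∈XY with ∈-map⁻ (x ,_) (subst (v ∈_) (verts-liftʳ x Q) v∈W)
      ... | h , h∈Q , refl =
        Sum.map (cong (x ,_)) (cong (x ,_)) (avoidQ h h∈Q (proj₂ (∈-cartesianProduct⁻ X Y v∈XY)))

    visible-detour : ∀ {x x' y y'} (VP : Visible (Adj G) X x x') → 2 ≤ len (Adj G) (proj₁ VP) →
                     Visible (Adj H) Y y y' →
                     Visible (□-Adj G H) (cartesianProduct X Y) (x , y) (x' , y')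
    visible-detour {x} {x'} {y} {y'} (cons _ e P₁@(cons g e' P) , shortestP , avoidP) _ (Q , shortestQ , avoidQ) =
      W , shortest-of-length {P = cons x e P₁} shortestP shortestQ W lenW , avoid
      where
      W : Walk (□-Adj G H) (x , y) (x' , y')
      W = cons (x , y) (inj₁ (e , refl)) (liftʳ g Q ++ʷ liftˡ y' P₁)

      lenW : len (□-Adj G H) W ≡ suc (len (Adj G) P₁) + len (Adj H) Q
      lenW = cong suc (begin
        len (□-Adj G H) (liftʳ g Q ++ʷ liftˡ y' P₁)
          ≡⟨ len-++ʷ (liftʳ g Q) (liftˡ y' P₁) ⟩
        len (□-Adj G H) (liftʳ g Q) + len (□-Adj G H) (liftˡ y' P₁)
          ≡⟨ cong₂ _+_ (len-liftʳ g Q) (len-liftˡ y' P₁) ⟩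
        len (Adj H) Q + len (Adj G) P₁
          ≡⟨ +-comm (len (Adj H) Q) (len (Adj G) P₁) ⟩
        len (Adj G) P₁ + len (Adj H) Q ∎)
        where open ≡-Reasoning

      g∉X : g ∉ X
      g∉X g∈X with avoidP g (there (here refl)) g∈X
      ... | inj₁ refl = shortest-head∉tail e P₁ shortestP (here refl)
      ... | inj₂ g≡x' = shortest-second≢last e e' P shortestP g≡x'

      avoid : ∀ v → v ∈ verts (□-Adj G H) W → v ∈ cartesianProduct X Y → v ≡ (x , y) ⊎ v ≡ (x' , y')
      avoid v (here v≡xy) _ = inj₁ v≡xy
      avoid v (there v∈) v∈XY with ∈-verts-++ʷ⁻ (liftʳ g Q) (liftˡ y' P₁) v∈ | ∈-cartesianProduct⁻ X Y v∈XY
      ... | inj₁ v∈Q | v₁∈X , _ with ∈-map⁻ (g ,_) (subst (v ∈_) (verts-liftʳ g Q) v∈Q)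
      ...   | _ , _ , refl = ⊥-elim (g∉X v₁∈X)
      avoid v (there v∈) v∈XY | inj₂ v∈P | v₁∈X , _ with ∈-map⁻ (_, y') (subst (v ∈_) (verts-liftˡ y' P₁) v∈P)
      ...   | g'' , g''∈P , refl with avoidP g'' (there g''∈P) v₁∈X
      ...     | inj₁ refl = ⊥-elim (shortest-head∉tail e P₁ shortestP g''∈P)
      ...     | inj₂ refl = inj₂ refl
    visible-detour (nil _ , _)              ()              _
    visible-detour (cons _ _ (nil _) , _)   (s≤s ())        _

module _ {n₁ n₂ : ℕ} (G : Graph n₁) (H : Graph n₂) where

  swapWalk : ∀ {p q} → Walk (□-Adj G H) p q → Walk (□-Adj H G) (Prod.swap p) (Prod.swap q)
  swapWalk (nil p)      = nil (Prod.swap p)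
  swapWalk (cons p e W) = cons (Prod.swap p) (Sum.swap (Sum.map Prod.swap Prod.swap e)) (swapWalk W)

  len-swapWalk : ∀ {p q} (W : Walk (□-Adj G H) p q) → len (□-Adj H G) (swapWalk W) ≡ len (□-Adj G H) W
  len-swapWalk (nil _)      = refl
  len-swapWalk (cons _ _ W) = cong suc (len-swapWalk W)

  verts-swapWalk : ∀ {p q} (W : Walk (□-Adj G H) p q) →
                   verts (□-Adj H G) (swapWalk W) ≡ map Prod.swap (verts (□-Adj G H) W)
  verts-swapWalk (nil _)      = refl
  verts-swapWalk (cons _ _ W) = cong (_ ∷_) (verts-swapWalk W)

module _ {n₁ n₂ : ℕ} {G : Graph n₁} {H : Graph n₂} {X : List (Fin n₁)} {Y : List (Fin n₂)} where

  visible-swap : ∀ {x x' y y'} → Visible (□-Adj H G) (cartesianProduct Y X) (y , x) (y' , x') →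
                 Visible (□-Adj G H) (cartesianProduct X Y) (x , y) (x' , y')
  visible-swap {x} {x'} {y} {y'} (W , shortestW , avoidW) =
    swapWalk H G W ,
    (λ W' → subst₂ _≤_ (sym (len-swapWalk H G W)) (len-swapWalk G H W') (shortestW (swapWalk G H W'))) ,
    avoid
    where
    avoid : ∀ v → v ∈ verts (□-Adj G H) (swapWalk H G W) → v ∈ cartesianProduct X Y →
            v ≡ (x , y) ⊎ v ≡ (x' , y')
    avoid v v∈W v∈XY with ∈-map⁻ Prod.swap (subst (v ∈_) (verts-swapWalk H G W) v∈W)
    ... | u , u∈W , refl =
      let (u₂∈X , u₁∈Y) = ∈-cartesianProduct⁻ X Y v∈XY in
      Sum.map (cong Prod.swap) (cong Prod.swap) (avoidW u u∈W (∈-cartesianProduct⁺ u₁∈Y u₂∈X))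

  product-visible : ∀ {x x' y y'} → Independent (Adj G) X → x ∈ X → x' ∈ X →
                    Visible (Adj G) X x x' → Visible (Adj H) Y y y' →
                    Visible (□-Adj G H) (cartesianProduct X Y) (x , y) (x' , y')
  product-visible _ _ _ VP@(cons _ _ (cons _ _ _) , _) VQ =
    CartesianProduct.visible-detour G H X Y VP (s≤s (s≤s z≤n)) VQ
  product-visible _ _ _ VP VQ@(cons _ _ (cons _ _ _) , _) =
    visible-swap (CartesianProduct.visible-detour H G Y X VQ (s≤s (s≤s z≤n)) VP)
  product-visible _ _ _ (nil _ , _) VQ = CartesianProduct.visible-alongʳ G H X Y VQ
  product-visible _ _ _ VP (nil _ , _) = visible-swap (CartesianProduct.visible-alongʳ H G Y X VP)
  product-visible independent x∈X x'∈X (cons _ e (nil _) , _) (cons _ _ (nil _) , _) =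
    ⊥-elim (independent x∈X x'∈X e)

  cartesianProduct-isMVSet : Independent (Adj G) X → IsMVSet (Adj G) X → IsMVSet (Adj H) Y →
                             IsMVSet (□-Adj G H) (cartesianProduct X Y)
  cartesianProduct-isMVSet independent (uniqueX , visibleX) (uniqueY , visibleY) =
    cartesianProduct⁺ uniqueX uniqueY , λ p q p∈XY q∈XY →
      let (p₁∈X , p₂∈Y) = ∈-cartesianProduct⁻ X Y p∈XY
          (q₁∈X , q₂∈Y) = ∈-cartesianProduct⁻ X Y q∈XY
      in product-visible independent p₁∈X q₁∈X (visibleX _ _ p₁∈X q₁∈X) (visibleY _ _ p₂∈Y q₂∈Y)

  length*length≤μ-□ : ∀ {m} → IsMu (□-Adj G H) m → Independent (Adj G) X →
                      IsMVSet (Adj G) X → IsMVSet (Adj H) Y → length X * length Y ≤ m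
  length*length≤μ-□ {m} (_ , maximal) independent mvX mvY =
    subst (_≤ m) (length-cartesianProduct X Y) (maximal _ (cartesianProduct-isMVSet independent mvX mvY))

∈-pair⁻ : {A : Set} {u v w : A} → w ∈ u ∷ v ∷ [] → w ≡ u ⊎ w ≡ v
∈-pair⁻ (here w≡u)         = inj₁ w≡u
∈-pair⁻ (there (here w≡v)) = inj₂ w≡v

unique-⊆-pair⇒length≤2 : {A : Set} {u v : A} {xs : List A} → Unique xs → xs ⊆ u ∷ v ∷ [] → length xs ≤ 2
unique-⊆-pair⇒length≤2 {xs = []}             _ _ = z≤n
unique-⊆-pair⇒length≤2 {xs = _ ∷ []}         _ _ = s≤s z≤n
unique-⊆-pair⇒length≤2 {xs = _ ∷ _ ∷ []}     _ _ = s≤s (s≤s z≤n)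
unique-⊆-pair⇒length≤2 {xs = _ ∷ _ ∷ _ ∷ _} ((x≢y ∷ x≢z ∷ _) ∷ (y≢z ∷ _) ∷ _) xs⊆
  with ∈-pair⁻ (xs⊆ (here refl)) | ∈-pair⁻ (xs⊆ (there (here refl))) | ∈-pair⁻ (xs⊆ (there (there (here refl))))
... | inj₁ refl | inj₁ refl | _         = ⊥-elim (x≢y refl)
... | inj₂ refl | inj₂ refl | _         = ⊥-elim (x≢y refl)
... | inj₁ refl | inj₂ refl | inj₁ refl = ⊥-elim (x≢z refl)
... | inj₂ refl | inj₁ refl | inj₂ refl = ⊥-elim (x≢z refl)
... | inj₁ refl | inj₂ refl | inj₂ refl = ⊥-elim (y≢z refl)
... | inj₂ refl | inj₁ refl | inj₁ refl = ⊥-elim (y≢z refl)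

pair-isMVSet : {V : Set} {E : V → V → Set} {a c : V} → a ≢ c →
               (P : Walk E a c) → IsShortest E P → (Q : Walk E c a) → IsShortest E Q →
               IsMVSet E (a ∷ c ∷ [])
pair-isMVSet {E = E} {a} {c} a≢c P shortestP Q shortestQ = ((a≢c ∷ []) ∷ [] ∷ []) , visible
  where
  visible-refl : ∀ x → Visible E (a ∷ c ∷ []) x x
  visible-refl x = nil x , (λ _ → z≤n) , λ { _ (here v≡x) _ → inj₁ v≡x }

  visible : ∀ x y → x ∈ a ∷ c ∷ [] → y ∈ a ∷ c ∷ [] → Visible E (a ∷ c ∷ []) x y
  visible x y x∈ y∈ with ∈-pair⁻ x∈ | ∈-pair⁻ y∈
  ... | inj₁ refl | inj₁ refl = visible-refl a
  ... | inj₂ refl | inj₂ refl = visible-refl c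
  ... | inj₁ refl | inj₂ refl = P , shortestP , λ _ _ v∈ → ∈-pair⁻ v∈
  ... | inj₂ refl | inj₁ refl = Q , shortestQ , λ _ _ v∈ → Sum.swap (∈-pair⁻ v∈)

connected⇒twoStep⊎adjacent : ∀ {k} (G : Graph k) → Connected (Adj G) →
                             ∀ x z → x ≢ z → WalkProperties.TwoStep (Adj G) ⊎ Adj G x z
connected⇒twoStep⊎adjacent G connected x z x≢z =
  let (P , pathP , _) = walk⇒path _≟_ (connected x z) in path⇒twoStep⊎adjacent P pathP x≢z
  where open WalkProperties (Adj G)

connected⇒twoStep : ∀ {k} (G : Graph (3 + k)) → Connected (Adj G) → WalkProperties.TwoStep (Adj G)
connected⇒twoStep G connected with connected⇒twoStep⊎adjacent G connected 0F (sucF (sucF 0F)) (λ ())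
... | inj₁ twoStep = twoStep
... | inj₂ 0~2 with connected⇒twoStep⊎adjacent G connected (sucF 0F) 0F (λ ())
...   | inj₁ twoStep = twoStep
...   | inj₂ 1~0     = sucF 0F , 0F , sucF (sucF 0F) , 1~0 , 0~2 , λ ()

module Acyclic {k : ℕ} (T : Graph k) (acyclic : ¬ HasCycle (Adj T)) where

  open WalkProperties (Adj T)

  adjacent⇒≢ : ∀ {u v} → Adj T u v → u ≢ v
  adjacent⇒≢ {u} uv refl = irrefl T u uv

  common-neighbour-avoided⇒≡ : ∀ {u s v} → Adj T u s → Adj T v u →
                               (W : Walk (Adj T) s v) → u ∉ verts (Adj T) W → s ≡ v
  common-neighbour-avoided⇒≡ {u} {v = v} us vu W u∉W with walk⇒path _≟_ W
  ... | nil _ , _ , _ = refl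
  ... | P@(cons _ _ _) , pathP , P⊆W =
    ⊥-elim (acyclic (u , v , cons u us P , ¬Any⇒All¬ _ (u∉W ∘ P⊆W) ∷ pathP , s≤s (s≤s z≤n) , vu))

  -- For w ∈ X off the edge uv, the X-avoiding shortest paths u → w and w → v form a walk
  -- from a neighbour s ≠ v of u to v that avoids u.
  mvSet-edge-⊆ : ∀ {X u v} → IsMVSet (Adj T) X → u ∈ X → v ∈ X → Adj T u v → X ⊆ u ∷ v ∷ []
  mvSet-edge-⊆ {u = u} {v} (_ , visible) u∈X v∈X uv {w} w∈X with w ≟ u | w ≟ v
  ... | yes refl | _        = here refl
  ... | no _     | yes refl = there (here refl)
  ... | no w≢u   | no w≢v   with visible u w u∈X w∈X | visible w v w∈X v∈X
  ...   | nil _ , _ , _                      | _ = ⊥-elim (w≢u refl)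
  ...   | cons _ {s} us Q , shortestQ , avoidQ | P , _ , avoidP =
    ⊥-elim (v∉Q (there (subst (_∈ verts (Adj T) Q) s≡v (head∈verts Q))))
    where
    v∉Q : v ∉ verts (Adj T) (cons u us Q)
    v∉Q v∈Q with avoidQ v v∈Q v∈X
    ... | inj₁ v≡u = adjacent⇒≢ uv (sym v≡u)
    ... | inj₂ v≡w = w≢v (sym v≡w)

    u∉Q++P : u ∉ verts (Adj T) (Q ++ʷ P)
    u∉Q++P u∈ with ∈-verts-++ʷ⁻ Q P u∈
    ... | inj₁ u∈Q = shortest-head∉tail us Q shortestQ u∈Q
    ... | inj₂ u∈P with avoidP u u∈P u∈X
    ...   | inj₁ u≡w = w≢u (sym u≡w)
    ...   | inj₂ u≡v = adjacent⇒≢ uv u≡v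

    s≡v : s ≡ v
    s≡v = common-neighbour-avoided⇒≡ us (adj-sym T u v uv) (Q ++ʷ P) u∉Q++P

  mvSet-edge⇒length≤2 : ∀ {X u v} → IsMVSet (Adj T) X → u ∈ X → v ∈ X → Adj T u v → length X ≤ 2
  mvSet-edge⇒length≤2 mv u∈X v∈X uv = unique-⊆-pair⇒length≤2 (proj₁ mv) (mvSet-edge-⊆ mv u∈X v∈X uv)

  module _ {a b c} (ab : Adj T a b) (bc : Adj T b c) (a≢c : a ≢ c) where

    twoStep-¬adjacent : ¬ Adj T a c
    twoStep-¬adjacent ac = acyclic (a , c , cons a ab (cons b bc (nil c)) ,
      (adjacent⇒≢ ab ∷ a≢c ∷ []) ∷ (adjacent⇒≢ bc ∷ []) ∷ [] ∷ [] , s≤s (s≤s z≤n) , adj-sym T a c ac)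

    twoStep-ends-independent : Independent (Adj T) (a ∷ c ∷ [])
    twoStep-ends-independent u∈ v∈ with ∈-pair⁻ u∈ | ∈-pair⁻ v∈
    ... | inj₁ refl | inj₁ refl = irrefl T a
    ... | inj₂ refl | inj₂ refl = irrefl T c
    ... | inj₁ refl | inj₂ refl = twoStep-¬adjacent
    ... | inj₂ refl | inj₁ refl = twoStep-¬adjacent ∘ adj-sym T c a

    twoStep-ends-isMVSet : IsMVSet (Adj T) (a ∷ c ∷ [])
    twoStep-ends-isMVSet =
      pair-isMVSet a≢c
        (cons a ab (cons b bc (nil c))) (2≤len a≢c twoStep-¬adjacent)
        (cons c (adj-sym T b c bc) (cons b (adj-sym T a b ab) (nil a)))
        (2≤len (a≢c ∘ sym) (twoStep-¬adjacent ∘ adj-sym T c a))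

corollary3p3 : (n₁ n₂ : ℕ) (T₁ : Graph n₁) (T₂ : Graph n₂) →
    IsTree T₁ → IsTree T₂ → 3 ≤ n₁ → 3 ≤ n₂ →
    (m₁ m₂ m : ℕ) →
    IsMu (Adj T₁) m₁ → IsMu (Adj T₂) m₂ → IsMu (□-Adj T₁ T₂) m →
    m₁ * m₂ ≤ m
corollary3p3 _ _ T₁ T₂ (connected₁ , acyclic₁) _ (s≤s (s≤s (s≤s _))) _ _ _ _
             ((X₁ , mv₁ , refl) , _) ((X₂ , mv₂ , refl) , _) μ
  with connected⇒twoStep T₁ connected₁ | length X₁ ≤? 2
... | a , b , c , ab , bc , a≢c | yes |X₁|≤2 =
  ≤-trans (*-monoˡ-≤ (length X₂) |X₁|≤2)
          (length*length≤μ-□ {G = T₁} {T₂} μ (twoStep-ends-independent ab bc a≢c) (twoStep-ends-isMVSet ab bc a≢c) mv₂)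
  where open Acyclic T₁ acyclic₁
... | _ | no |X₁|≰2 =
  length*length≤μ-□ {G = T₁} {T₂} μ (λ u∈ v∈ uv → |X₁|≰2 (mvSet-edge⇒length≤2 mv₁ u∈ v∈ uv)) mv₁ mv₂
  where open Acyclic T₁ acyclic₁
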